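{- Let $G=(V,E)$ be a chain graph. An edge $e\in E$ satisfies that $G-e$ is a chain graph if and only if $e$ is not the middle edge of an induced $P_4$ in $G$.
   Context: A chain graph is a bipartite graph whose vertex set can be partitioned into two independent sets $X$ and $Y$ such that the neighborhoods of the vertices in $X$ are linearly ordered by inclusion (equivalently, a $2K_2$-free bipartite graph). The middle edge of an induced $P_4$ is the edge joining its two degree-two vertices. -}

module Defs where

open import Data.Nat using (ℕ)
open import Data.Fin using (Fin)
open import Data.Fin.Properties using (_≟_)
open import Data.Bool using (Bool; true; false; _∧_; _∨_; not)
open import Data.Product using (Σ; ∃; _×_; _,_)
open import Data.Sum using (_⊎_)
open import Relation.Nullary using (¬_)
open import Relation.Nullary.Decidable using (⌊_⌋)
open import Relation.Binary.PropositionalEquality using (_≡_; _≢_)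

record Graph (n : ℕ) : Set where
  field
    adj   : Fin n → Fin n → Bool
    sym   : ∀ x y → adj x y ≡ adj y x
    irrefl : ∀ x → adj x x ≡ false
open Graph public

Adj : ∀ {n} → Graph n → Fin n → Fin n → Set
Adj G x y = adj G x y ≡ true

NbhdSubset : ∀ {n} → Graph n → Fin n → Fin n → Set
NbhdSubset G x x' = ∀ y → Adj G x y → Adj G x' y

IsChainGraph : ∀ {n} → Graph n → Set
IsChainGraph {n} G =
  Σ (Fin n → Bool) λ side →
    (∀ x y → Adj G x y → side x ≢ side y) ×
    (∀ x x' → side x ≡ true → side x' ≡ true →
       NbhdSubset G x x' ⊎ NbhdSubset G x' x)

samePair : ∀ {n} → Fin n → Fin n → Fin n → Fin n → Bool
samePair u v a b = (⌊ a ≟ u ⌋ ∧ ⌊ b ≟ v ⌋) ∨ (⌊ a ≟ v ⌋ ∧ ⌊ b ≟ u ⌋)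

deleteEdge : ∀ {n} → (G : Graph n) → Fin n → Fin n → Graph n
deleteEdge G u v = record
  { adj = λ a b → adj G a b ∧ not (samePair u v a b)
  ; sym = symProof
  ; irrefl = irrProof
  }
  where
  open import Data.Bool.Properties using (∧-zeroˡ; ∨-comm)
  open import Relation.Binary.PropositionalEquality using (cong₂; refl)
  samePairSym : ∀ a b → samePair u v a b ≡ samePair u v b a
  samePairSym a b with a ≟ u | b ≟ v | a ≟ v | b ≟ u
  ... | x1 | x2 | x3 | x4 = helper ⌊ x1 ⌋ ⌊ x2 ⌋ ⌊ x3 ⌋ ⌊ x4 ⌋
    where
    helper : ∀ p q r s → (p ∧ q) ∨ (r ∧ s) ≡ (s ∧ r) ∨ (q ∧ p)
    helper true true true true = refl
    helper true true true false = refl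
    helper true true false true = refl
    helper true true false false = refl
    helper true false true true = refl
    helper true false true false = refl
    helper true false false true = refl
    helper true false false false = refl
    helper false true true true = refl
    helper false true true false = refl
    helper false true false true = refl
    helper false true false false = refl
    helper false false true true = refl
    helper false false true false = refl
    helper false false false true = refl
    helper false false false false = refl
  symProof : ∀ a b → adj G a b ∧ not (samePair u v a b) ≡ adj G b a ∧ not (samePair u v b a)
  symProof a b = cong₂ (λ p q → p ∧ not q) (sym G a b) (samePairSym a b)
  irrProof : ∀ a → adj G a a ∧ not (samePair u v a a) ≡ false
  irrProof a rewrite irrefl G a = refl

InducedP4 : ∀ {n} → Graph n → Fin n → Fin n → Fin n → Fin n → Set
InducedP4 G a u v b =
  (a ≢ u) × (a ≢ v) × (a ≢ b) × (u ≢ v) × (u ≢ b) × (v ≢ b) ×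
  Adj G a u × Adj G u v × Adj G v b ×
  ¬ Adj G a v × ¬ Adj G u b × ¬ Adj G a b

-- The edge {u,v} is the middle edge of some induced P4 of G.
-- (Orientation a–v–u–b is covered by swapping names of a and b, since adjacency is symmetric.)
IsMiddleEdgeOfInducedP4 : ∀ {n} → Graph n → Fin n → Fin n → Set
IsMiddleEdgeOfInducedP4 G u v = ∃ λ a → ∃ λ b → InducedP4 G a u v b ⊎ InducedP4 G a v u b

{-# OPTIONS --safe #-}

-- A chain graph has no induced 2K₂, and deleting the middle edge uv of an
-- induced P4 a–u–v–b leaves the induced 2K₂ {au, vb}. Conversely, keep the
-- bipartition of G: if N(x') ⊆ N(x) in G, deleting uv can only break this
-- inclusion when x is an endpoint of uv and x' is still adjacent to its
-- partner y₀; then any y ∈ N(x) outside N(x') would make y–x–y₀–x' an induced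
-- P4 with middle edge uv, so the inclusion now holds the other way round.
module Submission where

open import Defs
open import Data.Nat using (ℕ)
open import Data.Fin using (Fin)
open import Data.Fin.Properties using (_≟_)
open import Data.Bool using (Bool; true; false)
import Data.Bool.Properties as Bool
open import Data.Product using (_×_; _,_; proj₁; ∃-syntax)
open import Data.Sum using (_⊎_; inj₁; inj₂; [_,_]; swap)
open import Function using (_∘_)
open import Relation.Nullary using (¬_; Dec; does; yes; no; contradiction)
open import Relation.Nullary.Decidable using (_×-dec_; _⊎-dec_; isYes≗does; dec-true; dec-false)
open import Relation.Binary.PropositionalEquality as ≡ using (_≡_; _≢_; refl; trans; subst)

private
  variable
    n : ℕ
    a b c d p q u v x x' y y₀ : Fin n

module _ (G : Graph n) where

  Adj? : ∀ x y → Dec (Adj G x y)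
  Adj? x y = adj G x y Bool.≟ true

  Adj-sym : Adj G x y → Adj G y x
  Adj-sym {x = x} {y = y} = trans (sym G y x)

  Adj⇒≢ : Adj G x y → x ≢ y
  Adj⇒≢ {x = x} xy refl with () ← trans (≡.sym (irrefl G x)) xy

  inducedP4 : Adj G a u → Adj G u v → Adj G v b →
              ¬ Adj G a v → ¬ Adj G u b → ¬ Adj G a b → InducedP4 G a u v b
  inducedP4 au uv vb ¬av ¬ub ¬ab =
    Adj⇒≢ au , (λ { refl → ¬ab vb }) , (λ { refl → ¬ub (Adj-sym au) }) ,
    Adj⇒≢ uv , (λ { refl → ¬ab au }) , Adj⇒≢ vb ,
    au , uv , vb , ¬av , ¬ub , ¬ab

Induced2K₂ : Graph n → Fin n → Fin n → Fin n → Fin n → Set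
Induced2K₂ G a b c d =
  Adj G a b × Adj G c d × ¬ Adj G a c × ¬ Adj G a d × ¬ Adj G b c × ¬ Adj G b d

module _ (G : Graph n) where

  Induced2K₂-swapˡ : Induced2K₂ G a b c d → Induced2K₂ G b a c d
  Induced2K₂-swapˡ (ab , cd , ¬ac , ¬ad , ¬bc , ¬bd) =
    Adj-sym G ab , cd , ¬bc , ¬bd , ¬ac , ¬ad

  Induced2K₂-swapʳ : Induced2K₂ G a b c d → Induced2K₂ G a b d c
  Induced2K₂-swapʳ (ab , cd , ¬ac , ¬ad , ¬bc , ¬bd) =
    ab , Adj-sym G cd , ¬ad , ¬ac , ¬bd , ¬bc

Bipartition : Graph n → (Fin n → Bool) → Set
Bipartition G side = ∀ x y → Adj G x y → side x ≢ side y

NestedNeighbourhoods : Graph n → (Fin n → Bool) → Set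
NestedNeighbourhoods G side = ∀ x x' → side x ≡ true → side x' ≡ true →
  NbhdSubset G x x' ⊎ NbhdSubset G x' x

≢⇒true⊎true : {s t : Bool} → s ≢ t → s ≡ true ⊎ t ≡ true
≢⇒true⊎true {true}          _   = inj₁ refl
≢⇒true⊎true {false} {true}  _   = inj₂ refl
≢⇒true⊎true {false} {false} s≢t = contradiction refl s≢t

module _ (G : Graph n) {side : Fin n → Bool} where

  X-neighbour-in-Y : Bipartition G side → side x ≡ true → Adj G x y → side y ≡ false
  X-neighbour-in-Y {x = x} {y = y} bip sx xy with side y in sy
  ... | false = refl
  ... | true  = contradiction (trans sx (≡.sym sy)) (bip x y xy)

  nested⇒cross-edge : NestedNeighbourhoods G side →
                      side x ≡ true → side y ≡ true → Adj G x a → Adj G y b →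
                      Adj G x b ⊎ Adj G y a
  nested⇒cross-edge {x = x} {y = y} {a = a} {b = b} nested sx sy xa yb
    with nested x y sx sy
  ... | inj₁ x⊆y = inj₂ (x⊆y a xa)
  ... | inj₂ y⊆x = inj₁ (y⊆x b yb)

  nested⇒no-induced-2K₂ : NestedNeighbourhoods G side →
    side a ≡ true → side c ≡ true → ¬ Induced2K₂ G a b c d
  nested⇒no-induced-2K₂ nested sa sc (ab , cd , _ , ¬ad , ¬bc , _) =
    [ ¬ad , ¬bc ∘ Adj-sym G ] (nested⇒cross-edge nested sa sc ab cd)

IsChainGraph⇒2K₂-free : (G : Graph n) → IsChainGraph G → ¬ Induced2K₂ G a b c d
IsChainGraph⇒2K₂-free {a = a} {b} {c} {d} G (side , bip , nested) i@(ab , cd , _)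
  with ≢⇒true⊎true (bip a b ab) | ≢⇒true⊎true (bip c d cd)
... | inj₁ sa | inj₁ sc = nested⇒no-induced-2K₂ G nested sa sc i
... | inj₁ sa | inj₂ sd = nested⇒no-induced-2K₂ G nested sa sd (Induced2K₂-swapʳ G i)
... | inj₂ sb | inj₁ sc = nested⇒no-induced-2K₂ G nested sb sc (Induced2K₂-swapˡ G i)
... | inj₂ sb | inj₂ sd =
  nested⇒no-induced-2K₂ G nested sb sd (Induced2K₂-swapˡ G (Induced2K₂-swapʳ G i))

SamePair : Fin n → Fin n → Fin n → Fin n → Set
SamePair u v a b = (a ≡ u × b ≡ v) ⊎ (a ≡ v × b ≡ u)

samePair? : ∀ (u v a b : Fin n) → Dec (SamePair u v a b)
samePair? u v a b = (a ≟ u ×-dec b ≟ v) ⊎-dec (a ≟ v ×-dec b ≟ u)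

samePair≡does-samePair? : ∀ (u v a b : Fin n) → samePair u v a b ≡ does (samePair? u v a b)
samePair≡does-samePair? u v a b
  rewrite isYes≗does (a ≟ u) | isYes≗does (b ≟ v) | isYes≗does (a ≟ v) | isYes≗does (b ≟ u)
  = refl

SamePair⇒samePair≡true : SamePair u v a b → samePair u v a b ≡ true
SamePair⇒samePair≡true {u = u} {v} {a} {b} s =
  trans (samePair≡does-samePair? u v a b) (dec-true (samePair? u v a b) s)

¬SamePair⇒samePair≡false : ¬ SamePair u v a b → samePair u v a b ≡ false
¬SamePair⇒samePair≡false {u = u} {v} {a} {b} ¬s =
  trans (samePair≡does-samePair? u v a b) (dec-false (samePair? u v a b) ¬s)

SamePair-endpoint : SamePair u v p q → SamePair u v a b → a ≡ p ⊎ a ≡ q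
SamePair-endpoint (inj₁ (refl , refl)) (inj₁ (refl , _)) = inj₁ refl
SamePair-endpoint (inj₁ (refl , refl)) (inj₂ (refl , _)) = inj₂ refl
SamePair-endpoint (inj₂ (refl , refl)) (inj₁ (refl , _)) = inj₂ refl
SamePair-endpoint (inj₂ (refl , refl)) (inj₂ (refl , _)) = inj₁ refl

SamePair-partner-unique : (G : Graph n) → Adj G u v →
                          SamePair u v x y → SamePair u v x y₀ → y ≡ y₀
SamePair-partner-unique _ _  (inj₁ (refl , refl)) (inj₁ (_ , refl)) = refl
SamePair-partner-unique G uv (inj₁ (refl , refl)) (inj₂ (x≡v , _)) =
  contradiction x≡v (Adj⇒≢ G uv)
SamePair-partner-unique G uv (inj₂ (refl , refl)) (inj₁ (x≡u , _)) =
  contradiction (≡.sym x≡u) (Adj⇒≢ G uv)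
SamePair-partner-unique _ _  (inj₂ (refl , refl)) (inj₂ (_ , refl)) = refl

SamePair-partner? : ∀ (u v x : Fin n) → (∃[ y₀ ] SamePair u v x y₀) ⊎ (∀ y → ¬ SamePair u v x y)
SamePair-partner? u v x with x ≟ u | x ≟ v
... | yes x≡u | _       = inj₁ (v , inj₁ (x≡u , refl))
... | no _    | yes x≡v = inj₁ (u , inj₂ (x≡v , refl))
... | no x≢u  | no x≢v  = inj₂ λ _ → [ x≢u ∘ proj₁ , x≢v ∘ proj₁ ]

SamePair-Adj : (G : Graph n) → Adj G u v → SamePair u v a b → Adj G a b
SamePair-Adj _ uv (inj₁ (refl , refl)) = uv
SamePair-Adj G uv (inj₂ (refl , refl)) = Adj-sym G uv

SamePair⇒middle : (G : Graph n) → SamePair u v p q → InducedP4 G a p q b →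
                  IsMiddleEdgeOfInducedP4 G u v
SamePair⇒middle _ (inj₁ (refl , refl)) P = _ , _ , inj₁ P
SamePair⇒middle _ (inj₂ (refl , refl)) P = _ , _ , inj₂ P

module _ (G : Graph n) (u v : Fin n) where

  private
    H : Graph n
    H = deleteEdge G u v

  deleteEdge-⊆ : Adj H a b → Adj G a b
  deleteEdge-⊆ {a = a} {b = b} = Bool.∧-conicalˡ (adj G a b) _

  deleteEdge-removes : SamePair u v a b → ¬ Adj H a b
  deleteEdge-removes {a = a} {b = b} s ab
    rewrite SamePair⇒samePair≡true s | Bool.∧-zeroʳ (adj G a b)
    with () ← ab

  deleteEdge-keeps : Adj G a b → ¬ SamePair u v a b → Adj H a b
  deleteEdge-keeps {a = a} {b = b} ab ¬s
    rewrite ab | ¬SamePair⇒samePair≡false ¬s = refl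

  deleteEdge-keeps-outside : SamePair u v p q → a ≢ p → a ≢ q → Adj G a b → Adj H a b
  deleteEdge-keeps-outside s a≢p a≢q ab =
    deleteEdge-keeps ab ([ a≢p , a≢q ] ∘ SamePair-endpoint s)

  P4-middle-deleted⇒induced-2K₂ : SamePair u v p q → InducedP4 G a p q b →
                                   Induced2K₂ H a p q b
  P4-middle-deleted⇒induced-2K₂ s
    (a≢p , a≢q , _ , _ , p≢b , q≢b , ap , _ , qb , ¬aq , ¬pb , ¬ab) =
    deleteEdge-keeps-outside s a≢p a≢q ap ,
    Adj-sym H (deleteEdge-keeps-outside s (p≢b ∘ ≡.sym) (q≢b ∘ ≡.sym) (Adj-sym G qb)) ,
    ¬aq ∘ deleteEdge-⊆ , ¬ab ∘ deleteEdge-⊆ , deleteEdge-removes s , ¬pb ∘ deleteEdge-⊆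

  deleteEdge-chain⇒¬middle : IsChainGraph H → ¬ IsMiddleEdgeOfInducedP4 G u v
  deleteEdge-chain⇒¬middle chain (_ , _ , inj₁ P) =
    IsChainGraph⇒2K₂-free H chain (P4-middle-deleted⇒induced-2K₂ (inj₁ (refl , refl)) P)
  deleteEdge-chain⇒¬middle chain (_ , _ , inj₂ P) =
    IsChainGraph⇒2K₂-free H chain (P4-middle-deleted⇒induced-2K₂ (inj₂ (refl , refl)) P)

  module _ {side : Fin n → Bool} (bip : Bipartition G side) (uv : Adj G u v)
           (sx : side x ≡ true) (sx' : side x' ≡ true) (x'⊆x : NbhdSubset G x' x) where

    nested-unpaired : (∀ y → ¬ SamePair u v x y) → NbhdSubset H x' x
    nested-unpaired unpaired y x'y =
      deleteEdge-keeps (x'⊆x y (deleteEdge-⊆ x'y)) (unpaired y)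

    nested-partner-lost : SamePair u v x y₀ → ¬ Adj H x' y₀ → NbhdSubset H x' x
    nested-partner-lost s ¬x'y₀ y x'y = deleteEdge-keeps (x'⊆x y (deleteEdge-⊆ x'y)) λ s' →
      ¬x'y₀ (subst (Adj H x') (SamePair-partner-unique G uv s' s) x'y)

    nested-partner-kept : ¬ IsMiddleEdgeOfInducedP4 G u v →
                          SamePair u v x y₀ → Adj H x' y₀ → NbhdSubset H x x'
    nested-partner-kept {y₀ = y₀} ¬middle s x'y₀ y xy' with Adj? G x' y
    ... | yes x'y = deleteEdge-keeps-outside s x'≢x (Adj⇒≢ G (deleteEdge-⊆ x'y₀)) x'y
      where
      x'≢x : x' ≢ x
      x'≢x refl = deleteEdge-removes s x'y₀
    ... | no ¬x'y = contradiction (SamePair⇒middle G s P4) ¬middle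
      where
      xy : Adj G x y
      xy = deleteEdge-⊆ xy'
      xy₀ : Adj G x y₀
      xy₀ = SamePair-Adj G uv s
      P4 : InducedP4 G y x y₀ x'
      P4 = inducedP4 G (Adj-sym G xy) xy₀ (Adj-sym G (deleteEdge-⊆ x'y₀))
        (λ yy₀ → bip y y₀ yy₀ (trans (X-neighbour-in-Y G bip sx xy)
                                     (≡.sym (X-neighbour-in-Y G bip sx xy₀))))
        (λ xx' → bip x x' xx' (trans sx (≡.sym sx')))
        (¬x'y ∘ Adj-sym G)

    deleteEdge-nested : ¬ IsMiddleEdgeOfInducedP4 G u v → NbhdSubset H x' x ⊎ NbhdSubset H x x'
    deleteEdge-nested ¬middle with SamePair-partner? u v x
    ... | inj₂ unpaired = inj₁ (nested-unpaired unpaired)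
    ... | inj₁ (y₀ , s) with Adj? H x' y₀
    ...   | yes x'y₀ = inj₂ (nested-partner-kept ¬middle s x'y₀)
    ...   | no ¬x'y₀ = inj₁ (nested-partner-lost s ¬x'y₀)

  ¬middle⇒deleteEdge-chain : IsChainGraph G → Adj G u v → ¬ IsMiddleEdgeOfInducedP4 G u v →
                             IsChainGraph H
  ¬middle⇒deleteEdge-chain (side , bip , nested) uv ¬middle =
    side , (λ x y → bip x y ∘ deleteEdge-⊆) , nested-H
    where
    nested-H : NestedNeighbourhoods H side
    nested-H x x' sx sx' with nested x x' sx sx'
    ... | inj₁ x⊆x' = deleteEdge-nested bip uv sx' sx x⊆x' ¬middle
    ... | inj₂ x'⊆x = swap (deleteEdge-nested bip uv sx sx' x'⊆x ¬middle)

lemma4p5 : ∀ {n} (G : Graph n) → IsChainGraph G →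
    ∀ (u v : Fin n) → Adj G u v →
      (IsChainGraph (deleteEdge G u v) → ¬ IsMiddleEdgeOfInducedP4 G u v) ×
      (¬ IsMiddleEdgeOfInducedP4 G u v → IsChainGraph (deleteEdge G u v))
lemma4p5 G chain u v uv =
  deleteEdge-chain⇒¬middle G u v , ¬middle⇒deleteEdge-chain G u v chain uv
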